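{- Let $f,g$ be Boolean functions, $k=\mathrm{Alt}(f)$, $\ell=\mathrm{Alt}(g)$, $a=f(\mathbf0)$, $b=g(\mathbf 0)$. Then: (i) $f\le_M g$ iff $k<\ell$ or $(k,a)=(\ell,b)$; (ii) $f\le_{M_0}g$ iff $k\le\ell$ and $a=b$; (iii) $f\le_{M_1}g$ iff $k\le\ell$ and $a+k\equiv b+\ell\pmod 2$; (iv) $f\le_{M_c}g$ iff $k\le\ell$, $a=b$ and $k\equiv\ell\pmod 2$.
   Context: A Boolean function is $f\colon\{0,1\}^n\to\{0,1\}$, $n\ge1$; $\mathbf0$ is the all-zero tuple, $\mathbf1$ the all-one tuple. For a clone $C$ of Boolean functions (set containing projections, closed under composition), $f\le_C g$ means $f=g(h_1,\dots,h_m)$ for some $h_1,\dots,h_m\in C$ ($g$ $m$-ary, all $h_i$ of the arity of $f$). $M$: clone of monotone functions (componentwise order); $M_0=\{f\in M:f(\mathbf0)=0\}$, $M_1=\{f\in M:f(\mathbf1)=1\}$, $M_c=M_0\cap M_1$. The alternation number $\mathrm{Alt}(f)$ of $n$-ary $f$ is the largest $d\ge0$ with $\mathbf a_0<\dots<\mathbf a_d$ in $\{0,1\}^n$ (componentwise order) and $f(\mathbf a_i)\ne f(\mathbf a_{i+1})$ for all $i<d$. -}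

module Defs where

open import Data.Bool using (Bool; true; false; _≤_; if_then_else_)
open import Data.Nat using (ℕ; zero; suc; _+_; _%_) renaming (_≤_ to _≤ℕ_; _<_ to _<ℕ_)
open import Data.Fin using (Fin; inject₁) renaming (suc to fsuc)
open import Data.Product using (Σ; ∃; _×_; _,_)
open import Relation.Binary.PropositionalEquality using (_≡_; _≢_)

-- tuples in {0,1}^n, with false = 0, true = 1
Tuple : ℕ → Set
Tuple n = Fin n → Bool

BoolFun : ℕ → Set
BoolFun n = Tuple n → Bool

𝟎 : ∀ {n} → Tuple n
𝟎 _ = false

𝟏 : ∀ {n} → Tuple n
𝟏 _ = true

_≤ᵗ_ : ∀ {n} → Tuple n → Tuple n → Set
a ≤ᵗ b = ∀ i → a i ≤ b i

_<ᵗ_ : ∀ {n} → Tuple n → Tuple n → Set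
a <ᵗ b = (a ≤ᵗ b) × (a ≢ b)

Monotone : ∀ {n} → BoolFun n → Set
Monotone f = ∀ a b → a ≤ᵗ b → f a ≤ f b

Pred : Set₁
Pred = ∀ {n} → BoolFun n → Set

M : Pred
M f = Monotone f

M₀ : Pred
M₀ f = Monotone f × (f 𝟎 ≡ false)

M₁ : Pred
M₁ f = Monotone f × (f 𝟏 ≡ true)

Mc : Pred
Mc f = M₀ f × M₁ f

Reduces : Pred → ∀ {n m} → BoolFun n → BoolFun m → Set
Reduces C {n} {m} f g =
  Σ (Fin m → BoolFun n) λ h →
    (∀ j → C (h j)) × (∀ x → f x ≡ g (λ j → h j x))

AltChain : ∀ {n} → BoolFun n → ℕ → Set
AltChain {n} f d =
  Σ (Fin (suc d) → Tuple n) λ a →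
    ∀ (i : Fin d) → (a (inject₁ i) <ᵗ a (fsuc i))
                  × (f (a (inject₁ i)) ≢ f (a (fsuc i)))

IsAlt : ∀ {n} → BoolFun n → ℕ → Set
IsAlt f k = AltChain f k × (∀ d → AltChain f d → d ≤ℕ k)

toℕ : Bool → ℕ
toℕ b = if b then 1 else 0

_≡₂_ : ℕ → ℕ → Set
x ≡₂ y = x % 2 ≡ y % 2

-- The level of a tuple x is k minus the length of a longest alternating chain of f starting at x.
-- It is monotone, rises from 0 at 𝟎 to k at 𝟏, and f x is f 𝟎 negated (level x) times.
-- A monotone reduction transports alternating chains of f to chains of g; this gives k ≤ ℓ,
-- k < ℓ when the values at 𝟎 differ, f 𝟎 = g 𝟎 for M₀ and f 𝟏 = g 𝟏 for M₁.
-- Conversely, a longest chain of g from 𝟎 with its top element replaced by 𝟏 is a staircase on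
-- which g alternates. Sending x to step φ (level x) of it reduces f to g whenever φ is a monotone
-- map of levels respecting the values, and lands in M₀ or M₁ when φ 0 = 0 or φ k = ℓ.
-- The maps u ↦ u, u + 1, u + (ℓ − k), and the last one with 0 kept fixed, cover the four cases;
-- when k or ℓ is 0, f is constant and is reduced by a projection.

module Submission where

open import Defs
open import Data.Nat using (ℕ; suc; _≤_; _<_; _+_)
open import Data.Bool using (Bool)
open import Data.Product using (_×_)
open import Data.Sum using (_⊎_)
open import Function.Bundles using (_⇔_)
open import Relation.Binary.PropositionalEquality using (_≡_)

open import Data.Bool as Bool using (true; false; not; b≤b)
import Data.Bool.Properties as Boolₚ
open import Data.Nat using (zero; _∸_; _%_; z≤n; s≤s)
open import Data.Nat.Properties
open import Data.Fin using (Fin; zero; suc; inject₁)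
open import Data.Fin.Properties using (all?)
open import Data.Fin.Subset.Properties using (anySubset?)
open import Data.Vec using (lookup; tabulate)
open import Data.Vec.Properties using (lookup∘tabulate)
open import Data.Product using (Σ; ∃; _,_; proj₁; proj₂; uncurry)
open import Data.Sum using (inj₁; inj₂)
import Data.Sum as Sum
open import Function using (_∘_; id)
open import Function.Bundles using (mk⇔; Equivalence)
open import Relation.Nullary using (¬_; Dec; yes; no; contradiction)
open import Relation.Nullary.Decidable using (decidable-stable; _×-dec_; ¬?)
import Relation.Nullary.Decidable as Dec
open import Relation.Binary.PropositionalEquality
  using (_≢_; _≗_; refl; sym; trans; cong; cong₂; cong-app; subst; ≢-sym; module ≡-Reasoning)

open Equivalence using (to; from)

private variable
  n m d : ℕ
  a b : Bool

infixl 6 _⊕_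

_⊕_ : Bool → ℕ → Bool
b ⊕ zero  = b
b ⊕ suc n = not b ⊕ n

⊕-not : ∀ b n → not b ⊕ n ≡ not (b ⊕ n)
⊕-not b zero    = refl
⊕-not b (suc n) = ⊕-not (not b) n

⊕-+ : ∀ b m n → b ⊕ (m + n) ≡ b ⊕ m ⊕ n
⊕-+ b zero    n = refl
⊕-+ b (suc m) n = ⊕-+ (not b) m n

⊕-involutive : ∀ b n → b ⊕ n ⊕ n ≡ b
⊕-involutive b zero    = refl
⊕-involutive b (suc n) = begin
  not (not b ⊕ n) ⊕ n    ≡⟨ cong (λ c → not c ⊕ n) (⊕-not b n) ⟩
  not (not (b ⊕ n)) ⊕ n  ≡⟨ cong (_⊕ n) (Boolₚ.not-involutive (b ⊕ n)) ⟩
  b ⊕ n ⊕ n              ≡⟨ ⊕-involutive b n ⟩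
  b                      ∎
  where open ≡-Reasoning

⊕-swap : ∀ n → a ≡ b ⊕ n → b ≡ a ⊕ n
⊕-swap {b = b} n a≡b⊕n = trans (sym (⊕-involutive b n)) (cong (_⊕ n) (sym a≡b⊕n))

⊕-cancelʳ : ∀ n → a ⊕ n ≡ b ⊕ n → a ≡ b
⊕-cancelʳ {a} n a⊕n≡b⊕n = sym (trans (⊕-swap n a⊕n≡b⊕n) (⊕-involutive a n))

⊕-cancel-∸ : m ≤ n → a ⊕ m ≡ b ⊕ n → a ≡ b ⊕ (n ∸ m)
⊕-cancel-∸ {m} {n} {a} {b} m≤n a⊕m≡b⊕n = ⊕-cancelʳ m (begin
  a ⊕ m            ≡⟨ a⊕m≡b⊕n ⟩
  b ⊕ n            ≡⟨ cong (b ⊕_) (sym (m∸n+n≡m m≤n)) ⟩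
  b ⊕ (n ∸ m + m)  ≡⟨ ⊕-+ b (n ∸ m) m ⟩
  b ⊕ (n ∸ m) ⊕ m  ∎)
  where open ≡-Reasoning

⊕-flip-base : ∀ a m n → a ⊕ m ≡ a ⊕ n → not a ⊕ m ≡ not a ⊕ n
⊕-flip-base a m n e = trans (⊕-not a m) (trans (cong not e) (sym (⊕-not a n)))

toℕ-injective : toℕ a ≡ toℕ b → a ≡ b
toℕ-injective {false} {false} _ = refl
toℕ-injective {false} {true}  ()
toℕ-injective {true}  {false} ()
toℕ-injective {true}  {true}  _ = refl

toℕ-⊕ : ∀ b n → toℕ (b ⊕ n) ≡ (toℕ b + n) % 2
toℕ-⊕ false zero    = refl
toℕ-⊕ true  zero    = refl
toℕ-⊕ false (suc n) = toℕ-⊕ true n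
toℕ-⊕ true  (suc n) = toℕ-⊕ false n

≡₂⇔⊕≡ : ∀ a b m n → (toℕ a + m) ≡₂ (toℕ b + n) ⇔ a ⊕ m ≡ b ⊕ n
≡₂⇔⊕≡ a b m n = mk⇔
  (λ e → toℕ-injective (trans (toℕ-⊕ a m) (trans e (sym (toℕ-⊕ b n)))))
  (λ e → trans (sym (toℕ-⊕ a m)) (trans (cong toℕ e) (toℕ-⊕ b n)))

≡₂⇔⊕≡-same : ∀ a m n → m ≡₂ n ⇔ a ⊕ m ≡ a ⊕ n
≡₂⇔⊕≡-same false m n = ≡₂⇔⊕≡ false false m n
≡₂⇔⊕≡-same true  m n = mk⇔
  (⊕-flip-base false m n ∘ to (≡₂⇔⊕≡ false false m n))
  (from (≡₂⇔⊕≡ false false m n) ∘ ⊕-flip-base true m n)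

≤ᵗ-refl : {x : Tuple n} → x ≤ᵗ x
≤ᵗ-refl _ = b≤b

≤ᵗ-trans : {x y z : Tuple n} → x ≤ᵗ y → y ≤ᵗ z → x ≤ᵗ z
≤ᵗ-trans x≤y y≤z i = Boolₚ.≤-trans (x≤y i) (y≤z i)

≗⇒≤ᵗ : {x y : Tuple n} → x ≗ y → x ≤ᵗ y
≗⇒≤ᵗ x≗y i = Boolₚ.≤-reflexive (x≗y i)

𝟎≤ᵗ : (x : Tuple n) → 𝟎 ≤ᵗ x
𝟎≤ᵗ x i = Boolₚ.≤-minimum (x i)

≤ᵗ𝟏 : (x : Tuple n) → x ≤ᵗ 𝟏
≤ᵗ𝟏 x i = Boolₚ.≤-maximum (x i)

𝟏≤ᵗ⇒≗𝟏 : {x : Tuple n} → 𝟏 ≤ᵗ x → 𝟏 ≗ x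
𝟏≤ᵗ⇒≗𝟏 {x = x} 𝟏≤x i with x i | 𝟏≤x i
... | true | b≤b = refl

_≤ᵗ?_ : (x y : Tuple n) → Dec (x ≤ᵗ y)
x ≤ᵗ? y = all? (λ i → x i Boolₚ.≤? y i)

-- The search runs over vectors, which represent tuples only up to pointwise equality.
∃-tuple? : (P : Tuple n → Set) → (∀ {x y} → x ≗ y → P x → P y) → (∀ x → Dec (P x)) → Dec (∃ P)
∃-tuple? P resp P? = Dec.map
  (mk⇔ (λ (v , Pv) → lookup v , Pv) (λ (x , Px) → tabulate x , resp (sym ∘ lookup∘tabulate x) Px))
  (anySubset? (P? ∘ lookup))

greatest : {P : ℕ → Set} → (∀ d → Dec (P d)) → P 0 → ∀ bound → (∀ {d} → P d → d ≤ bound)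
         → Σ ℕ λ d → P d × (∀ {e} → P e → e ≤ d)
greatest P? P0 zero        bounded = 0 , P0 , bounded
greatest P? P0 (suc bound) bounded with P? (suc bound)
... | yes P[1+bound] = suc bound , P[1+bound] , bounded
... | no ¬P[1+bound] = greatest P? P0 bound λ Pd →
  ≤-pred (≤∧≢⇒< (bounded Pd) λ { refl → ¬P[1+bound] Pd })

data Chain (f : BoolFun n) : ℕ → Tuple n → Set where
  []   : ∀ {x} → Chain f 0 x
  step : ∀ {d x y} → x ≤ᵗ y → f x ≢ f y → Chain f d y → Chain f (suc d) x

module _ {f : BoolFun n} where

  elements : ∀ {x} → Chain f d x → Fin (suc d) → Tuple n
  elements {x = x} _            zero    = x
  elements         (step _ _ c) (suc i) = elements c i

  toAltChain : ∀ {x} → Chain f d x → AltChain f d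
  toAltChain c = elements c , links c
    where
    links : ∀ {d x} (c : Chain f d x) (i : Fin d)
          → (elements c (inject₁ i) <ᵗ elements c (suc i)) × (f (elements c (inject₁ i)) ≢ f (elements c (suc i)))
    links (step x≤y fx≢fy _) zero    = (x≤y , fx≢fy ∘ cong f) , fx≢fy
    links (step _   _     c) (suc i) = links c i

  fromAltChain : (c : AltChain f d) → Chain f d (proj₁ c zero)
  fromAltChain {zero}  _       = []
  fromAltChain {suc d} (a , links) =
    step (proj₁ (proj₁ (links zero))) (proj₂ (links zero)) (fromAltChain (a ∘ suc , links ∘ suc))

  zigzag : ∀ d {x y} → x ≗ y → f x ≢ f y → Chain f d x
  zigzag zero    _   _     = []
  zigzag (suc d) x≗y fx≢fy = step (≗⇒≤ᵗ x≗y) fx≢fy (zigzag d (sym ∘ x≗y) (≢-sym fx≢fy))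

  chain-lower : ∀ {x y} → x ≤ᵗ y → Chain f d y → Chain f d x ⊎ Chain f (suc d) x
  chain-lower {x = x} {y} x≤y c with f x Bool.≟ f y
  chain-lower x≤y []                 | yes _     = inj₁ []
  chain-lower x≤y (step y≤z fy≢fz c) | yes fx≡fy = inj₁ (step (≤ᵗ-trans x≤y y≤z) (fy≢fz ∘ trans (sym fx≡fy)) c)
  ... | no fx≢fy = inj₂ (step x≤y fx≢fy c)

  stair : ∀ {x} → Chain f d x → ℕ → Tuple n
  stair             []           _       = 𝟏
  stair {x = x}     (step _ _ _) zero    = x
  stair             (step _ _ c) (suc i) = stair c i

  stair-≥ : ∀ {x} (c : Chain f d x) i → x ≤ᵗ stair c i
  stair-≥ []                 _       = ≤ᵗ𝟏 _
  stair-≥ (step _   _ _)     zero    = ≤ᵗ-refl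
  stair-≥ (step x≤y _ c)     (suc i) = ≤ᵗ-trans x≤y (stair-≥ c i)

  stair-mono : ∀ {x i j} (c : Chain f d x) → i ≤ j → stair c i ≤ᵗ stair c j
  stair-mono []             _         = ≤ᵗ-refl
  stair-mono {j = j} c@(step _ _ _) z≤n = stair-≥ c j
  stair-mono (step _ _ c)   (s≤s i≤j) = stair-mono c i≤j

  stair-head : ∀ {x} (c : Chain f d x) → 0 < d → stair c 0 ≡ x
  stair-head (step _ _ _) _ = refl

  stair-last : ∀ {x} (c : Chain f d x) → stair c d ≡ 𝟏
  stair-last []           = refl
  stair-last (step _ _ c) = stair-last c

  stair-value : ∀ {x i} (c : Chain f d x) → f 𝟏 ≡ f x ⊕ d → i ≤ d → f (stair c i) ≡ f x ⊕ i
  stair-value []           f𝟏≡ z≤n = f𝟏≡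
  stair-value (step _ _ _) _   z≤n = refl
  stair-value {x = x} {suc i} (step {d = d} {y = y} _ fx≢fy c) f𝟏≡ (s≤s i≤d) =
    trans (stair-value c (trans f𝟏≡ (cong (_⊕ d) (sym fy≡))) i≤d) (cong (_⊕ i) fy≡)
    where
    fy≡ : f y ≡ not (f x)
    fy≡ = Boolₚ.¬-not (≢-sym fx≢fy)

chain-map : {f : BoolFun n} {g : BoolFun m} (H : Tuple n → Tuple m)
          → (∀ {x y} → x ≤ᵗ y → H x ≤ᵗ H y) → (∀ x → f x ≡ g (H x))
          → ∀ {x} → Chain f d x → Chain g d (H x)
chain-map H H-mono f≡g∘H []                 = []
chain-map H H-mono f≡g∘H (step x≤y fx≢fy c) =
  step (H-mono x≤y) (λ e → fx≢fy (trans (f≡g∘H _) (trans e (sym (f≡g∘H _))))) (chain-map H H-mono f≡g∘H c)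

module Alternation (f : BoolFun n) (k : ℕ) (alt : IsAlt f k) where

  chain-bound : ∀ {x} → Chain f d x → d ≤ k
  chain-bound c = proj₂ alt _ (toAltChain c)

  -- Without function extensionality this needs an argument: if f x ≢ f y, then x, y, x, … alternates forever.
  resp : ∀ {x y} → x ≗ y → f x ≡ f y
  resp {x} {y} x≗y = decidable-stable (f x Bool.≟ f y) λ fx≢fy →
    1+n≰n (chain-bound (zigzag (suc k) x≗y fx≢fy))

  chain-resp : ∀ {x y} → x ≗ y → Chain f d x → Chain f d y
  chain-resp _   []                 = []
  chain-resp x≗y (step x≤z fx≢fz c) =
    step (λ i → subst (Bool._≤ _) (x≗y i) (x≤z i)) (fx≢fz ∘ trans (resp x≗y)) c

  chain? : ∀ d x → Dec (Chain f d x)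
  chain? zero    x = yes []
  chain? (suc d) x = Dec.map (mk⇔ join split)
    (∃-tuple? Next next-resp λ y → (x ≤ᵗ? y) ×-dec ¬? (f x Bool.≟ f y) ×-dec chain? d y)
    where
    Next : Tuple n → Set
    Next y = x ≤ᵗ y × f x ≢ f y × Chain f d y

    join : ∃ Next → Chain f (suc d) x
    join (_ , x≤y , fx≢fy , c) = step x≤y fx≢fy c

    split : Chain f (suc d) x → ∃ Next
    split (step x≤y fx≢fy c) = _ , x≤y , fx≢fy , c

    next-resp : ∀ {y z} → y ≗ z → Next y → Next z
    next-resp y≗z (x≤y , fx≢fy , c) =
      (λ i → subst (x i Bool.≤_) (y≗z i) (x≤y i)) , (λ e → fx≢fy (trans e (sym (resp y≗z)))) , chain-resp y≗z c

  longest : ∀ x → Σ ℕ λ d → Chain f d x × (∀ {e} → Chain f e x → e ≤ d)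
  longest x = greatest (λ d → chain? d x) [] k chain-bound

  depth : Tuple n → ℕ
  depth x = proj₁ (longest x)

  depth-chain : ∀ x → Chain f (depth x) x
  depth-chain x = proj₁ (proj₂ (longest x))

  depth-maximal : ∀ {x} → Chain f d x → d ≤ depth x
  depth-maximal {x = x} = proj₂ (proj₂ (longest x))

  depth≤k : ∀ x → depth x ≤ k
  depth≤k x = chain-bound (depth-chain x)

  depth-antitone : ∀ {x y} → x ≤ᵗ y → depth y ≤ depth x
  depth-antitone x≤y with chain-lower x≤y (depth-chain _)
  ... | inj₁ c = depth-maximal c
  ... | inj₂ c = <⇒≤ (depth-maximal c)

  maximal-chain-value : ∀ {x} → Chain f d x → ¬ Chain f (suc d) x → f x ≡ f 𝟏 ⊕ d
  maximal-chain-value {x = x} [] no-step =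
    decidable-stable (f x Bool.≟ f 𝟏) λ fx≢f𝟏 → no-step (step (≤ᵗ𝟏 x) fx≢f𝟏 [])
  maximal-chain-value {x = x} (step {d = d} {y = y} x≤y fx≢fy c) no-longer = begin
    f x            ≡⟨ Boolₚ.¬-not fx≢fy ⟩
    not (f y)      ≡⟨ cong not (maximal-chain-value c (no-longer ∘ step x≤y fx≢fy)) ⟩
    not (f 𝟏 ⊕ d)  ≡⟨ sym (⊕-not (f 𝟏) d) ⟩
    not (f 𝟏) ⊕ d  ∎
    where open ≡-Reasoning

  depth-value : ∀ x → f x ≡ f 𝟏 ⊕ depth x
  depth-value x = maximal-chain-value (depth-chain x) (1+n≰n ∘ depth-maximal)

  chain𝟎 : Chain f k 𝟎
  chain𝟎 with chain-lower (𝟎≤ᵗ _) (fromAltChain (proj₁ alt))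
  ... | inj₁ c = c
  ... | inj₂ c = contradiction (chain-bound c) 1+n≰n

  depth-𝟎 : depth 𝟎 ≡ k
  depth-𝟎 = ≤-antisym (depth≤k 𝟎) (depth-maximal chain𝟎)

  depth-𝟏 : depth 𝟏 ≡ 0
  depth-𝟏 = chain-from-𝟏 (depth-chain 𝟏)
    where
    chain-from-𝟏 : Chain f d 𝟏 → d ≡ 0
    chain-from-𝟏 []                   = refl
    chain-from-𝟏 (step 𝟏≤y f𝟏≢fy _) = contradiction (resp (𝟏≤ᵗ⇒≗𝟏 𝟏≤y)) f𝟏≢fy

  level : Tuple n → ℕ
  level x = k ∸ depth x

  level-mono : ∀ {x y} → x ≤ᵗ y → level x ≤ level y
  level-mono x≤y = ∸-monoʳ-≤ k (depth-antitone x≤y)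

  level≤k : ∀ x → level x ≤ k
  level≤k x = m∸n≤m k (depth x)

  level-𝟎 : level 𝟎 ≡ 0
  level-𝟎 = trans (cong (k ∸_) depth-𝟎) (n∸n≡0 k)

  level-𝟏 : level 𝟏 ≡ k
  level-𝟏 = cong (k ∸_) depth-𝟏

  level-value : ∀ x → f x ≡ f 𝟎 ⊕ level x
  level-value x = ⊕-swap (level x) (begin
    f 𝟎                        ≡⟨ depth-value 𝟎 ⟩
    f 𝟏 ⊕ depth 𝟎              ≡⟨ cong (f 𝟏 ⊕_) (trans depth-𝟎 (sym (m+[n∸m]≡n (depth≤k x)))) ⟩
    f 𝟏 ⊕ (depth x + level x)  ≡⟨ ⊕-+ (f 𝟏) (depth x) (level x) ⟩
    f 𝟏 ⊕ depth x ⊕ level x    ≡⟨ cong (_⊕ level x) (sym (depth-value x)) ⟩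
    f x ⊕ level x              ∎)
    where open ≡-Reasoning

  value-𝟏 : f 𝟏 ≡ f 𝟎 ⊕ k
  value-𝟏 = trans (level-value 𝟏) (cong (f 𝟎 ⊕_) level-𝟏)

  constant : k ≡ 0 → ∀ x → f x ≡ f 𝟎
  constant k≡0 x = trans (level-value x) (cong (f 𝟎 ⊕_) (n≤0⇒n≡0 (subst (level x ≤_) k≡0 (level≤k x))))

  staircase : ℕ → Tuple n
  staircase = stair chain𝟎

  staircase-mono : ∀ {i j} → i ≤ j → staircase i ≤ᵗ staircase j
  staircase-mono = stair-mono chain𝟎

  staircase-𝟎 : 0 < k → staircase 0 ≡ 𝟎
  staircase-𝟎 = stair-head chain𝟎

  staircase-𝟏 : staircase k ≡ 𝟏
  staircase-𝟏 = stair-last chain𝟎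

  staircase-value : ∀ {i} → i ≤ k → f (staircase i) ≡ f 𝟎 ⊕ i
  staircase-value = stair-value chain𝟎 value-𝟏

-- The reason f must have positive arity: the inner functions project to the first coordinate.
constant-reduces : {f : BoolFun (suc n)} {g : BoolFun m} {c : Bool}
                 → (∀ x → f x ≡ c) → g 𝟎 ≡ c → g 𝟏 ≡ c → Reduces Mc f g
constant-reduces {f = f} {g} f≡c g𝟎≡c g𝟏≡c = (λ _ x → x zero) , (λ _ → (mono , refl) , (mono , refl)) , f≡g∘diagonal
  where
  mono : Monotone (λ (x : Tuple (suc _)) → x zero)
  mono _ _ x≤y = x≤y zero

  f≡g∘diagonal : ∀ x → f x ≡ g (λ _ → x zero)
  f≡g∘diagonal x with x zero
  ... | false = trans (f≡c x) (sym g𝟎≡c)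
  ... | true  = trans (f≡c x) (sym g𝟏≡c)

stretch : ℕ → ℕ → ℕ
stretch d zero    = zero
stretch d (suc u) = d + suc u

stretch-mono : ∀ {u v} → u ≤ v → stretch d u ≤ stretch d v
stretch-mono         z≤n       = z≤n
stretch-mono {d = d} (s≤s u≤v) = +-monoʳ-≤ d (s≤s u≤v)

stretch≤ : ∀ d u → stretch d u ≤ d + u
stretch≤ d zero    = z≤n
stretch≤ d (suc u) = ≤-refl

stretch-pos : ∀ {u} → 0 < u → stretch d u ≡ d + u
stretch-pos {u = suc u} _ = refl

module Reductions (f : BoolFun (suc n)) (g : BoolFun m) (k ℓ : ℕ) (altf : IsAlt f k) (altg : IsAlt g ℓ) where
  private
    module F = Alternation f k altf
    module G = Alternation g ℓ altg

  Reduces-mono : {C D : Pred} → (∀ {p} {h : BoolFun p} → C h → D h) → Reduces C f g → Reduces D f g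
  Reduces-mono C⊆D (h , h∈C , f≡g∘h) = h , C⊆D ∘ h∈C , f≡g∘h

  transport : (r : Reduces M f g) → ∀ {x} → Chain f d x → Chain g d (λ j → proj₁ r j x)
  transport (h , h-mono , f≡g∘h) = chain-map (λ x j → h j x) (λ x≤y j → h-mono j _ _ x≤y) f≡g∘h

  reduces-M⇒≤ : Reduces M f g → k ≤ ℓ
  reduces-M⇒≤ r = G.chain-bound (transport r F.chain𝟎)

  -- If the value at 𝟎 changes, the transported chain can be prolonged downwards by 𝟎.
  reduces-M⇒< : Reduces M f g → f 𝟎 ≢ g 𝟎 → k < ℓ
  reduces-M⇒< r@(_ , _ , f≡g∘h) f𝟎≢g𝟎 =
    G.chain-bound (step (𝟎≤ᵗ _) (λ e → f𝟎≢g𝟎 (trans (f≡g∘h 𝟎) (sym e))) (transport r F.chain𝟎))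

  reduces-M₀⇒ : Reduces M₀ f g → f 𝟎 ≡ g 𝟎
  reduces-M₀⇒ (_ , h∈M₀ , f≡g∘h) = trans (f≡g∘h 𝟎) (G.resp (proj₂ ∘ h∈M₀))

  reduces-M₁⇒ : Reduces M₁ f g → f 𝟎 ⊕ k ≡ g 𝟎 ⊕ ℓ
  reduces-M₁⇒ (h , h∈M₁ , f≡g∘h) = begin
    f 𝟎 ⊕ k              ≡⟨ sym F.value-𝟏 ⟩
    f 𝟏                  ≡⟨ f≡g∘h 𝟏 ⟩
    g (λ j → h j 𝟏)      ≡⟨ G.resp (proj₂ ∘ h∈M₁) ⟩
    g 𝟏                  ≡⟨ G.value-𝟏 ⟩
    g 𝟎 ⊕ ℓ              ∎
    where open ≡-Reasoning

  record LevelMap : Set where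
    field
      φ         : ℕ → ℕ
      φ-mono    : ∀ {u v} → u ≤ v → φ u ≤ φ v
      φ-bounded : ∀ {u} → u ≤ k → φ u ≤ ℓ
      φ-value   : ∀ u → f 𝟎 ⊕ u ≡ g 𝟎 ⊕ φ u

  open LevelMap

  inner : LevelMap → Fin m → BoolFun (suc n)
  inner L j x = G.staircase (φ L (F.level x)) j

  inner-M : (L : LevelMap) → ∀ j → M (inner L j)
  inner-M L j _ _ x≤y = G.staircase-mono (φ-mono L (F.level-mono x≤y)) j

  inner-M₀ : (L : LevelMap) → 0 < ℓ → φ L 0 ≡ 0 → ∀ j → M₀ (inner L j)
  inner-M₀ L 0<ℓ φ0≡0 j = inner-M L j , cong-app (begin
    G.staircase (φ L (F.level 𝟎))  ≡⟨ cong (G.staircase ∘ φ L) F.level-𝟎 ⟩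
    G.staircase (φ L 0)            ≡⟨ cong G.staircase φ0≡0 ⟩
    G.staircase 0                  ≡⟨ G.staircase-𝟎 0<ℓ ⟩
    𝟎                              ∎) j
    where open ≡-Reasoning

  inner-M₁ : (L : LevelMap) → φ L k ≡ ℓ → ∀ j → M₁ (inner L j)
  inner-M₁ L φk≡ℓ j = inner-M L j , cong-app (begin
    G.staircase (φ L (F.level 𝟏))  ≡⟨ cong (G.staircase ∘ φ L) F.level-𝟏 ⟩
    G.staircase (φ L k)            ≡⟨ cong G.staircase φk≡ℓ ⟩
    G.staircase ℓ                  ≡⟨ G.staircase-𝟏 ⟩
    𝟏                              ∎) j
    where open ≡-Reasoning

  reduces : {C : Pred} (L : LevelMap) → (∀ j → C (inner L j)) → Reduces C f g
  reduces L inner∈C = inner L , inner∈C , λ x → begin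
    f x                                ≡⟨ F.level-value x ⟩
    f 𝟎 ⊕ F.level x                    ≡⟨ φ-value L (F.level x) ⟩
    g 𝟎 ⊕ φ L (F.level x)              ≡⟨ sym (G.staircase-value (φ-bounded L (F.level≤k x))) ⟩
    g (G.staircase (φ L (F.level x)))  ∎
    where open ≡-Reasoning

  identity-map : k ≤ ℓ → f 𝟎 ≡ g 𝟎 → LevelMap
  identity-map k≤ℓ f𝟎≡g𝟎 = record
    { φ         = id
    ; φ-mono    = id
    ; φ-bounded = λ u≤k → ≤-trans u≤k k≤ℓ
    ; φ-value   = λ u → cong (_⊕ u) f𝟎≡g𝟎
    }

  successor-map : k < ℓ → f 𝟎 ≢ g 𝟎 → LevelMap
  successor-map k<ℓ f𝟎≢g𝟎 = record
    { φ         = suc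
    ; φ-mono    = s≤s
    ; φ-bounded = λ u≤k → ≤-trans (s≤s u≤k) k<ℓ
    ; φ-value   = λ u → cong (_⊕ u) (Boolₚ.¬-not f𝟎≢g𝟎)
    }

  shift-bounded : k ≤ ℓ → ∀ {u} → u ≤ k → ℓ ∸ k + u ≤ ℓ
  shift-bounded k≤ℓ u≤k = ≤-trans (+-monoʳ-≤ (ℓ ∸ k) u≤k) (≤-reflexive (m∸n+n≡m k≤ℓ))

  shift-map : k ≤ ℓ → f 𝟎 ⊕ k ≡ g 𝟎 ⊕ ℓ → LevelMap
  shift-map k≤ℓ f𝟏≡g𝟏 = record
    { φ         = ℓ ∸ k +_
    ; φ-mono    = +-monoʳ-≤ (ℓ ∸ k)
    ; φ-bounded = shift-bounded k≤ℓ
    ; φ-value   = λ u → trans (cong (_⊕ u) (⊕-cancel-∸ k≤ℓ f𝟏≡g𝟏)) (sym (⊕-+ (g 𝟎) (ℓ ∸ k) u))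
    }

  stretch-map : k ≤ ℓ → f 𝟎 ≡ g 𝟎 → f 𝟎 ⊕ k ≡ g 𝟎 ⊕ ℓ → LevelMap
  stretch-map k≤ℓ f𝟎≡g𝟎 f𝟏≡g𝟏 = record
    { φ         = stretch (ℓ ∸ k)
    ; φ-mono    = stretch-mono
    ; φ-bounded = λ {u} u≤k → ≤-trans (stretch≤ (ℓ ∸ k) u) (shift-bounded k≤ℓ u≤k)
    ; φ-value   = λ { zero → f𝟎≡g𝟎 ; (suc u) → φ-value (shift-map k≤ℓ f𝟏≡g𝟏) (suc u) }
    }

  reduces-Mc : k ≤ ℓ → f 𝟎 ≡ g 𝟎 → f 𝟎 ⊕ k ≡ g 𝟎 ⊕ ℓ → Reduces Mc f g
  -- For k = 0 no level map sends 0 both to 0 and to ℓ > 0.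
  reduces-Mc k≤ℓ f𝟎≡g𝟎 f𝟏≡g𝟏 with k ≟ 0
  ... | yes k≡0 = constant-reduces {f = f} {g = g} (F.constant k≡0) (sym f𝟎≡g𝟎) g𝟏≡f𝟎
    where
    g𝟏≡f𝟎 : g 𝟏 ≡ f 𝟎
    g𝟏≡f𝟎 = trans G.value-𝟏 (trans (sym f𝟏≡g𝟏) (cong (f 𝟎 ⊕_) k≡0))
  ... | no k≢0 = reduces {C = Mc} L λ j → inner-M₀ L (<-≤-trans 0<k k≤ℓ) refl j , inner-M₁ L φk≡ℓ j
    where
    L = stretch-map k≤ℓ f𝟎≡g𝟎 f𝟏≡g𝟏
    0<k = n≢0⇒n>0 k≢0
    φk≡ℓ : stretch (ℓ ∸ k) k ≡ ℓ
    φk≡ℓ = trans (stretch-pos 0<k) (m∸n+n≡m k≤ℓ)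

  reduces-M₀ : k ≤ ℓ → f 𝟎 ≡ g 𝟎 → Reduces M₀ f g
  -- For ℓ = 0 the staircase of g is constantly 𝟏.
  reduces-M₀ k≤ℓ f𝟎≡g𝟎 with ℓ ≟ 0
  ... | yes ℓ≡0 = Reduces-mono {C = Mc} {D = M₀} proj₁ (reduces-Mc k≤ℓ f𝟎≡g𝟎 (cong₂ _⊕_ f𝟎≡g𝟎 k≡ℓ))
    where
    k≡ℓ : k ≡ ℓ
    k≡ℓ = trans (n≤0⇒n≡0 (subst (k ≤_) ℓ≡0 k≤ℓ)) (sym ℓ≡0)
  ... | no ℓ≢0 = reduces {C = M₀} L (inner-M₀ L (n≢0⇒n>0 ℓ≢0) refl)
    where
    L = identity-map k≤ℓ f𝟎≡g𝟎

  reduces-M₁ : k ≤ ℓ → f 𝟎 ⊕ k ≡ g 𝟎 ⊕ ℓ → Reduces M₁ f g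
  reduces-M₁ k≤ℓ f𝟏≡g𝟏 = reduces {C = M₁} L (inner-M₁ L (m∸n+n≡m k≤ℓ))
    where
    L = shift-map k≤ℓ f𝟏≡g𝟏

  reduces-M : k < ℓ → Reduces M f g
  reduces-M k<ℓ with f 𝟎 Bool.≟ g 𝟎
  ... | yes f𝟎≡g𝟎 = Reduces-mono {C = M₀} {D = M} proj₁ (reduces-M₀ (<⇒≤ k<ℓ) f𝟎≡g𝟎)
  ... | no f𝟎≢g𝟎  = reduces {C = M} L (inner-M L)
    where
    L = successor-map k<ℓ f𝟎≢g𝟎

  M-criterion : Reduces M f g ⇔ (k < ℓ ⊎ (k ≡ ℓ × f 𝟎 ≡ g 𝟎))
  M-criterion = mk⇔ necessary sufficient
    where
    necessary : Reduces M f g → k < ℓ ⊎ (k ≡ ℓ × f 𝟎 ≡ g 𝟎)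
    necessary r with f 𝟎 Bool.≟ g 𝟎
    ... | no f𝟎≢g𝟎  = inj₁ (reduces-M⇒< r f𝟎≢g𝟎)
    ... | yes f𝟎≡g𝟎 = Sum.map₂ (_, f𝟎≡g𝟎) (m≤n⇒m<n∨m≡n (reduces-M⇒≤ r))

    sufficient : k < ℓ ⊎ (k ≡ ℓ × f 𝟎 ≡ g 𝟎) → Reduces M f g
    sufficient (inj₁ k<ℓ)           = reduces-M k<ℓ
    sufficient (inj₂ (k≡ℓ , f𝟎≡g𝟎)) = Reduces-mono {C = M₀} {D = M} proj₁ (reduces-M₀ (≤-reflexive k≡ℓ) f𝟎≡g𝟎)

  M₀-criterion : Reduces M₀ f g ⇔ (k ≤ ℓ × f 𝟎 ≡ g 𝟎)
  M₀-criterion = mk⇔ (λ r → reduces-M⇒≤ (Reduces-mono {C = M₀} {D = M} proj₁ r) , reduces-M₀⇒ r) (uncurry reduces-M₀)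

  M₁-criterion : Reduces M₁ f g ⇔ (k ≤ ℓ × (toℕ (f 𝟎) + k) ≡₂ (toℕ (g 𝟎) + ℓ))
  M₁-criterion = mk⇔
    (λ r → reduces-M⇒≤ (Reduces-mono {C = M₁} {D = M} proj₁ r) , from parity (reduces-M₁⇒ r))
    (λ (k≤ℓ , k≡₂ℓ) → reduces-M₁ k≤ℓ (to parity k≡₂ℓ))
    where
    parity = ≡₂⇔⊕≡ (f 𝟎) (g 𝟎) k ℓ

  Mc-criterion : Reduces Mc f g ⇔ (k ≤ ℓ × f 𝟎 ≡ g 𝟎 × k ≡₂ ℓ)
  Mc-criterion = mk⇔ necessary sufficient
    where
    parity = ≡₂⇔⊕≡-same (f 𝟎) k ℓ

    necessary : Reduces Mc f g → k ≤ ℓ × f 𝟎 ≡ g 𝟎 × k ≡₂ ℓ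
    necessary r = proj₁ (to M₀-criterion r₀) , f𝟎≡g𝟎
                , from parity (trans (reduces-M₁⇒ r₁) (cong (_⊕ ℓ) (sym f𝟎≡g𝟎)))
      where
      r₀ = Reduces-mono {C = Mc} {D = M₀} proj₁ r
      r₁ = Reduces-mono {C = Mc} {D = M₁} proj₂ r
      f𝟎≡g𝟎 = reduces-M₀⇒ r₀

    sufficient : k ≤ ℓ × f 𝟎 ≡ g 𝟎 × k ≡₂ ℓ → Reduces Mc f g
    sufficient (k≤ℓ , f𝟎≡g𝟎 , k≡₂ℓ) = reduces-Mc k≤ℓ f𝟎≡g𝟎 (trans (to parity k≡₂ℓ) (cong (_⊕ ℓ) f𝟎≡g𝟎))

proposition6p4 : ∀ {n m} (f : BoolFun (suc n)) (g : BoolFun (suc m)) (k ℓ : ℕ) (a b : Bool)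
    → IsAlt f k → IsAlt g ℓ → f 𝟎 ≡ a → g 𝟎 ≡ b
    → (Reduces M f g ⇔ (k < ℓ ⊎ (k ≡ ℓ × a ≡ b)))
    × (Reduces M₀ f g ⇔ (k ≤ ℓ × a ≡ b))
    × (Reduces M₁ f g ⇔ (k ≤ ℓ × (toℕ a + k) ≡₂ (toℕ b + ℓ)))
    × (Reduces Mc f g ⇔ (k ≤ ℓ × a ≡ b × k ≡₂ ℓ))
proposition6p4 f g k ℓ _ _ altf altg refl refl = M-criterion , M₀-criterion , M₁-criterion , Mc-criterion
  where open Reductions f g k ℓ altf altg
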